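{- Let $\mathcal{F}$ be a finite union-closed family of sets with $\emptyset\notin\mathcal{F}$, $n=|\bigcup_{A\in\mathcal{F}}A|$ and $m=|\mathcal{F}|$. If the height number satisfies $H(\mathcal{F})\le3$ and $m>2n$, then there exists an element $x$ which belongs to more than half of the sets of $\mathcal{F}$.
   Context: A union-closed family is a finite family $\mathcal{F}$ of finite sets closed under pairwise union. Height decomposition: $\pi_1$ is the set of inclusion-minimal members of $\mathcal{F}$; inductively, while $\mathcal{F}\setminus(\pi_1\cup\dots\cup\pi_{i-1})\neq\emptyset$, $\pi_i$ is the set of inclusion-minimal members of $\mathcal{F}\setminus(\pi_1\cup\dots\cup\pi_{i-1})$; the number of steps until $\mathcal{F}$ is exhausted is the height number $H(\mathcal{F})$. -}

module Defs where

open import Data.Nat using (ℕ; zero; suc)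
open import Data.List using (List; []; _∷_; filter; length)
open import Data.List.Relation.Unary.Any using (Any; any?)
open import Data.List.Relation.Unary.Unique.Propositional using (Unique)
open import Data.List.Membership.Propositional using (_∈_; _∉_)
open import Data.Fin using (Fin)
open import Data.Fin.Subset using (Subset; _∪_; _⊂_; ⊥)
open import Data.Fin.Subset.Properties using (_⊂?_; _∈?_)
open import Data.Product using (_×_)

import Data.Fin.Subset as S

-- A finite family of finite sets: a duplicate-free list of subsets of a
-- finite ground set Fin N.
Family : ℕ → Set
Family N = List (Subset N)

UnionClosed : ∀ {N} → Family N → Set
UnionClosed F = ∀ {A B} → A ∈ F → B ∈ F → (A ∪ B) ∈ F

removeMinimal : ∀ {N} → List (Subset N) → List (Subset N)
removeMinimal L = filter (λ A → any? (λ B → B ⊂? A) L) L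

-- Height number: HeightIs F h  iff the height decomposition of F
-- (repeatedly stripping the inclusion-minimal members) takes exactly h steps.
data HeightIs {N : ℕ} : List (Subset N) → ℕ → Set where
  height-[] : HeightIs [] 0
  height-∷  : ∀ {A L h} → HeightIs (removeMinimal (A ∷ L)) h → HeightIs (A ∷ L) (suc h)

count : ∀ {N} → Fin N → Family N → ℕ
count x F = length (filter (λ A → x ∈? A) F)

unionSize : ∀ {N} → Family N → ℕ
unionSize F = S.∣ S.⋃ F ∣

-- Let U = ⋃F; it is a member, nonempty since ∅ ∉ F, so fix x ∈ U. The members avoiding x
-- lie below their union T, again a member, and T ⊂ U. Sending B ⊊ T to a point of T ∖ B and T
-- to x is injective: if a ≠ b miss a common point of T, one of them is strictly below a ∪ b,
-- and a ⊂ a ∪ b ⊂ T ⊂ U (or the same with b) is a chain of four members, impossible when the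
-- height is at most 3. Hence at most n members avoid x, and m > 2n makes x a majority element.
module Submission where

open import Defs
open import Data.Nat using (ℕ; _*_; _≤_; _<_)
open import Data.List using (length)
open import Data.List.Relation.Unary.Unique.Propositional using (Unique)
open import Data.List.Membership.Propositional using (_∉_)
open import Data.Fin using (Fin)
open import Data.Fin.Subset using (⊥)
open import Data.Product using (∃; _×_)

open import Data.Nat using (suc; _+_; z≤n; s≤s)
open import Data.Nat.Properties
  using (≤-trans; <⇒≱; +-identityʳ; +-suc; +-mono-≤; +-monoʳ-<; +-cancelʳ-<; module ≤-Reasoning)
open import Data.List using (List; []; _∷_; filter)
open import Data.List.Membership.Propositional using (_∈_; lose)
open import Data.List.Membership.Propositional.Properties using (∈-filter⁺; ∈-filter⁻)
open import Data.List.Relation.Unary.Any using (here; there; any?)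
import Data.List.Relation.Unary.All as All
open import Data.List.Relation.Unary.AllPairs using (_∷_)
import Data.List.Relation.Unary.Unique.Propositional.Properties as Unique
open import Data.Fin.Subset using (Subset; _∪_; _⊆_; _⊂_; ⋃; ∣_∣; _-_)
  renaming (_∈_ to _∈ₛ_; _∉_ to _∉ₛ_)
open import Data.Fin.Subset.Properties
  using (_⊂?_; _∈?_; ⊆-antisym; ⊆-trans; p⊆p∪q; q⊆p∪q; x∈p∪q⁻; ∪-identityʳ; ∉⊥;
         nonempty?; Empty-unique; x∈p∧x≢y⇒x∈p-y; x∈p⇒∣p-x∣<∣p∣)
import Data.Fin.Properties as Fin
open import Data.Product using (_,_; proj₁; proj₂)
open import Data.Sum using (_⊎_; inj₁; inj₂; [_,_]′)
open import Data.Empty using (⊥-elim)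
open import Relation.Nullary using (¬_; yes; no; ¬?)
open import Relation.Nullary.Decidable using (_×-dec_; decidable-stable)
open import Relation.Unary using (Pred; Decidable)
open import Relation.Unary.Properties using (∁?)
open import Relation.Binary.PropositionalEquality using (_≡_; refl; sym; trans; cong; subst)

module _ {N : ℕ} where

  ⊆-or-outside : (A B : Subset N) → A ⊆ B ⊎ ∃ λ z → z ∈ₛ A × z ∉ₛ B
  ⊆-or-outside A B with Fin.any? (λ z → (z ∈? A) ×-dec ¬? (z ∈? B))
  ... | yes outside = inj₂ outside
  ... | no ∄outside = inj₁ λ {z} z∈A →
    decidable-stable (z ∈? B) (λ z∉B → ∄outside (z , z∈A , z∉B))

  ⊆⇒≡⊎⊂ : ∀ {A B : Subset N} → A ⊆ B → A ≡ B ⊎ A ⊂ B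
  ⊆⇒≡⊎⊂ {A} {B} A⊆B with ⊆-or-outside B A
  ... | inj₁ B⊆A = inj₁ (⊆-antisym A⊆B B⊆A)
  ... | inj₂ outside = inj₂ (A⊆B , outside)

  ∪-least : ∀ {A B C : Subset N} → A ⊆ C → B ⊆ C → A ∪ B ⊆ C
  ∪-least {A} {B} A⊆C B⊆C z∈A∪B with x∈p∪q⁻ A B z∈A∪B
  ... | inj₁ z∈A = A⊆C z∈A
  ... | inj₂ z∈B = B⊆C z∈B

  ⊆⋃ : ∀ {A} {L : List (Subset N)} → A ∈ L → A ⊆ ⋃ L
  ⊆⋃ {L = B ∷ L} (here refl) = p⊆p∪q (⋃ L)
  ⊆⋃ {L = B ∷ L} (there A∈L) = ⊆-trans (⊆⋃ A∈L) (q⊆p∪q B (⋃ L))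

  ∉⋃ : ∀ {x} (L : List (Subset N)) → (∀ {B} → B ∈ L → x ∉ₛ B) → x ∉ₛ ⋃ L
  ∉⋃ [] _ = ∉⊥
  ∉⋃ (B ∷ L) ∉L x∈⋃ with x∈p∪q⁻ B (⋃ L) x∈⋃
  ... | inj₁ x∈B = ∉L (here refl) x∈B
  ... | inj₂ x∈⋃L = ∉⋃ L (λ B∈L → ∉L (there B∈L)) x∈⋃L

  ⋃∈ : ∀ {F : Family N} → UnionClosed F → (A : Subset N) (L : List (Subset N)) →
       (∀ {B} → B ∈ A ∷ L → B ∈ F) → ⋃ (A ∷ L) ∈ F
  ⋃∈ {F} _ A [] ⊆F = subst (_∈ F) (sym (∪-identityʳ A)) (⊆F (here refl))
  ⋃∈ closed A (B ∷ L) ⊆F = closed (⊆F (here refl)) (⋃∈ closed B L (λ B∈ → ⊆F (there B∈)))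

module _ {N : ℕ} {A : Set} (f : A → Fin N) where

  injectiveOn⇒length≤∣∣ : ∀ {U} (xs : List A) → Unique xs → (∀ {a} → a ∈ xs → f a ∈ₛ U) →
                          (∀ {a b} → a ∈ xs → b ∈ xs → f a ≡ f b → a ≡ b) → length xs ≤ ∣ U ∣
  injectiveOn⇒length≤∣∣ [] _ _ _ = z≤n
  injectiveOn⇒length≤∣∣ {U} (a ∷ xs) (a∉xs ∷ unique) into injective =
    ≤-trans (s≤s rest≤) (x∈p⇒∣p-x∣<∣p∣ (into (here refl)))
    where
    rest≤ : length xs ≤ ∣ U - f a ∣
    rest≤ = injectiveOn⇒length≤∣∣ xs unique
      (λ b∈xs → x∈p∧x≢y⇒x∈p-y (into (there b∈xs))
                  (λ fb≡fa → All.lookup a∉xs b∈xs (sym (injective (there b∈xs) (here refl) fb≡fa))))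
      (λ a∈xs b∈xs → injective (there a∈xs) (there b∈xs))

module _ {a p} {A : Set a} {P : Pred A p} (P? : Decidable P) where

  length-filter-∁ : ∀ xs → length xs ≡ length (filter P? xs) + length (filter (∁? P?) xs)
  length-filter-∁ [] = refl
  length-filter-∁ (x ∷ xs) with P? x
  ... | yes _ = cong suc (length-filter-∁ xs)
  ... | no _ = trans (cong suc (length-filter-∁ xs)) (sym (+-suc _ _))

majority : ∀ {c g n} → g ≤ n → 2 * n < c + g → c + g < 2 * c
majority {c} {g} {n} g≤n 2n<c+g = begin-strict
    c + g   <⟨ +-monoʳ-< c g<c ⟩
    c + c   ≡⟨ cong (c +_) (sym (+-identityʳ c)) ⟩
    2 * c   ∎
  where
  open ≤-Reasoning
  g<c : g < c
  g<c = +-cancelʳ-< g g c (begin-strict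
      g + g   ≤⟨ +-mono-≤ g≤n g≤n ⟩
      n + n   ≡⟨ cong (n +_) (sym (+-identityʳ n)) ⟩
      2 * n   <⟨ 2n<c+g ⟩
      c + g   ∎)

infixr 5 _⊂⟨_⟩_

data Chain {N : ℕ} (L : List (Subset N)) : ℕ → Subset N → Set where
  [_]    : ∀ {A} → A ∈ L → Chain L 1 A
  _⊂⟨_⟩_ : ∀ {A B k} → A ∈ L → A ⊂ B → Chain L k B → Chain L (suc k) A

module _ {N : ℕ} {L : List (Subset N)} where

  ∈removeMinimal : ∀ {A B} → A ∈ L → B ∈ L → A ⊂ B → B ∈ removeMinimal L
  ∈removeMinimal A∈L B∈L A⊂B = ∈-filter⁺ (λ C → any? (λ D → D ⊂? C) L) B∈L (lose A∈L A⊂B)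

  chain-removeMinimal : ∀ {A B k} → A ∈ L → A ⊂ B → Chain L k B → Chain (removeMinimal L) k B
  chain-removeMinimal A∈L A⊂B [ B∈L ] = [ ∈removeMinimal A∈L B∈L A⊂B ]
  chain-removeMinimal A∈L A⊂B (B∈L ⊂⟨ B⊂C ⟩ chain) =
    ∈removeMinimal A∈L B∈L A⊂B ⊂⟨ B⊂C ⟩ chain-removeMinimal B∈L B⊂C chain

chain-length≤height : ∀ {N} {L : List (Subset N)} {h k A} → HeightIs L h → Chain L k A → k ≤ h
chain-length≤height height-[] [ () ]
chain-length≤height height-[] (() ⊂⟨ _ ⟩ _)
chain-length≤height (height-∷ _) [ _ ] = s≤s z≤n
chain-length≤height (height-∷ height) (A∈L ⊂⟨ A⊂B ⟩ chain) =
  s≤s (chain-length≤height height (chain-removeMinimal A∈L A⊂B chain))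

module _ {N : ℕ} {F : Family N} (closed : UnionClosed F) (no-4-chain : ∀ {A} → ¬ Chain F 4 A) where

  ≡-if-outside-same : ∀ {a b T U z} → a ∈ F → b ∈ F → T ∈ F → U ∈ F → a ⊆ T → b ⊆ T → T ⊂ U →
                      z ∈ₛ T → z ∉ₛ a → z ∉ₛ b → a ≡ b
  ≡-if-outside-same {a} {b} {T} {_} {z} a∈F b∈F T∈F U∈F a⊆T b⊆T T⊂U z∈T z∉a z∉b =
    conclude (⊆⇒≡⊎⊂ (p⊆p∪q b)) (⊆⇒≡⊎⊂ (q⊆p∪q a b))
    where
    a∪b⊂T : a ∪ b ⊂ T
    a∪b⊂T = ∪-least a⊆T b⊆T , z , z∈T , λ z∈a∪b → [ z∉a , z∉b ]′ (x∈p∪q⁻ a b z∈a∪b)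
    chain-from-a∪b : Chain F 3 (a ∪ b)
    chain-from-a∪b = closed a∈F b∈F ⊂⟨ a∪b⊂T ⟩ T∈F ⊂⟨ T⊂U ⟩ [ U∈F ]
    conclude : a ≡ a ∪ b ⊎ a ⊂ a ∪ b → b ≡ a ∪ b ⊎ b ⊂ a ∪ b → a ≡ b
    conclude (inj₁ a≡a∪b) (inj₁ b≡a∪b) = trans a≡a∪b (sym b≡a∪b)
    conclude (inj₂ a⊂a∪b) _ = ⊥-elim (no-4-chain (a∈F ⊂⟨ a⊂a∪b ⟩ chain-from-a∪b))
    conclude _ (inj₂ b⊂a∪b) = ⊥-elim (no-4-chain (b∈F ⊂⟨ b⊂a∪b ⟩ chain-from-a∪b))

  below-length≤ : ∀ {T U} → T ∈ F → U ∈ F → T ⊂ U → (G : List (Subset N)) → Unique G →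
                  (∀ {B} → B ∈ G → B ∈ F × B ⊆ T) → length G ≤ ∣ U ∣
  below-length≤ {T} {U} T∈F U∈F T⊂U@(T⊆U , x , x∈U , x∉T) G unique below =
    injectiveOn⇒length≤∣∣ label G unique label∈U label-injective
    where
    label : Subset N → Fin N
    label B = [ (λ _ → x) , proj₁ ]′ (⊆-or-outside T B)
    label∈U : ∀ {B} → B ∈ G → label B ∈ₛ U
    label∈U {B} _ with ⊆-or-outside T B
    ... | inj₁ _ = x∈U
    ... | inj₂ (_ , z∈T , _) = T⊆U z∈T
    label-injective : ∀ {a b} → a ∈ G → b ∈ G → label a ≡ label b → a ≡ b
    label-injective {a} {b} a∈G b∈G with below a∈G | below b∈G | ⊆-or-outside T a | ⊆-or-outside T b
    ... | _ , a⊆T | _ , b⊆T | inj₁ T⊆a | inj₁ T⊆b = λ _ → trans (⊆-antisym a⊆T T⊆a) (⊆-antisym T⊆b b⊆T)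
    ... | _ | _ | inj₁ _ | inj₂ (z , z∈T , _) = λ x≡z → ⊥-elim (x∉T (subst (_∈ₛ T) (sym x≡z) z∈T))
    ... | _ | _ | inj₂ (z , z∈T , _) | inj₁ _ = λ z≡x → ⊥-elim (x∉T (subst (_∈ₛ T) z≡x z∈T))
    ... | a∈F , a⊆T | b∈F , b⊆T | inj₂ (z , z∈T , z∉a) | inj₂ (_ , _ , z∉b) = λ { refl →
      ≡-if-outside-same a∈F b∈F T∈F U∈F a⊆T b⊆T T⊂U z∈T z∉a z∉b }

  avoiding-length≤ : ∀ {U x} → U ∈ F → (∀ {B} → B ∈ F → B ⊆ U) → x ∈ₛ U →
                     (G : List (Subset N)) → Unique G → (∀ {B} → B ∈ G → B ∈ F × x ∉ₛ B) →
                     length G ≤ ∣ U ∣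
  avoiding-length≤ _ _ _ [] _ _ = z≤n
  avoiding-length≤ {x = x} U∈F ⊆U x∈U G@(A ∷ G′) unique avoiding =
    below-length≤ ⋃G∈F U∈F (⊆U ⋃G∈F , x , x∈U , x∉⋃G) G unique
      (λ B∈G → proj₁ (avoiding B∈G) , ⊆⋃ B∈G)
    where
    ⋃G∈F : ⋃ G ∈ F
    ⋃G∈F = ⋃∈ closed A G′ (λ B∈G → proj₁ (avoiding B∈G))
    x∉⋃G : x ∉ₛ ⋃ G
    x∉⋃G = ∉⋃ G (λ B∈G → proj₂ (avoiding B∈G))

proposition3p2p1 : (N : ℕ) (F : Family N) → Unique F → UnionClosed F → ⊥ ∉ F
    → (∃ λ h → HeightIs F h × h ≤ 3)
    → 2 * unionSize F < length F
    → ∃ λ (x : Fin N) → length F < 2 * count x F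
proposition3p2p1 N [] _ _ _ _ ()
proposition3p2p1 N F@(A ∷ F′) unique closed ⊥∉F (h , height , h≤3) 2n<m =
  x , subst (_< 2 * count x F) (sym split) (majority avoiders≤n (subst (2 * unionSize F <_) split 2n<m))
  where
  ⋃F∈F : ⋃ F ∈ F
  ⋃F∈F = ⋃∈ closed A F′ (λ B∈F → B∈F)
  no-4-chain : ∀ {B} → ¬ Chain F 4 B
  no-4-chain chain = <⇒≱ (s≤s h≤3) (chain-length≤height height chain)
  point : ∃ λ x → x ∈ₛ ⋃ F
  point with nonempty? (⋃ F)
  ... | yes x∈⋃F = x∈⋃F
  ... | no ⋃F-empty = ⊥-elim (⊥∉F (subst (_∈ F) (Empty-unique ⋃F-empty) ⋃F∈F))
  x : Fin N
  x = proj₁ point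
  split : length F ≡ count x F + length (filter (∁? (x ∈?_)) F)
  split = length-filter-∁ (x ∈?_) F
  avoiders≤n : length (filter (∁? (x ∈?_)) F) ≤ unionSize F
  avoiders≤n = avoiding-length≤ closed no-4-chain ⋃F∈F ⊆⋃ (proj₂ point) _
    (Unique.filter⁺ (∁? (x ∈?_)) unique) (∈-filter⁻ (∁? (x ∈?_)))
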